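{- Let $\{a_s\}_{s\ge 1}$ and $\{b_s\}_{s\ge 1}$ be sequences of natural numbers with $\lim_{s\to\infty}a_s=\lim_{s\to\infty}b_s=\infty$, and for each $s\ge1$ let $\mu(s)=(b_s^{a_s})$ be the rectangular partition of $a_sb_s$ with $a_s$ parts each equal to $b_s$. Then for every $\beta>0$ there exists $s_0$ such that $f^{\mu(s)}>\beta^{a_sb_s}$ for every $s\ge s_0$.
   Context: For a partition $\lambda\vdash n$, $f^\lambda$ denotes the degree of the ordinary irreducible character of the symmetric group $S_n$ corresponding to $\lambda$ (equivalently, the number of standard Young tableaux of shape $\lambda$). The notation $(b^a)$ denotes the partition $(b,b,\ldots,b)$ with $a$ parts.
   Formalization: The parameter β ranges over the positive rationals. -}

module Defs where

open import Data.Nat using (ℕ; zero; suc; _+_; _*_; _<ᵇ_; _≡ᵇ_; _≤_)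
open import Data.Bool using (Bool; true; false; _∧_; _∨_; not)
open import Data.List using (List; []; _∷_; length; filter; concatMap; map; replicate; upTo)
open import Data.Nat.ListAction using (sum)
open import Data.Product using (∃)
open import Relation.Nullary.Decidable using (does)
open import Data.Bool.Properties using (T?)
open import Data.Bool using (T)

-- A partition is given as a weakly decreasing list of positive parts.
Partition : Set
Partition = List ℕ

size : Partition → ℕ
size = sum

listsOf : {A : Set} → ℕ → List A → List (List A)
listsOf zero    xs = [] ∷ []
listsOf (suc l) xs = concatMap (λ x → map (x ∷_) (listsOf l xs)) xs

fillings : Partition → List ℕ → List (List (List ℕ))
fillings []      xs = [] ∷ []
fillings (r ∷ la) xs = concatMap (λ row → map (row ∷_) (fillings la xs)) (listsOf r xs)

incr : List ℕ → Bool
incr []           = true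
incr (x ∷ [])     = true
incr (x ∷ y ∷ ys) = (x <ᵇ y) ∧ incr (y ∷ ys)

below : List ℕ → List ℕ → Bool
below (u ∷ us) (l ∷ ls) = (u <ᵇ l) ∧ below us ls
below _        _        = true

rowsOK : List (List ℕ) → Bool
rowsOK []       = true
rowsOK (r ∷ rs) = incr r ∧ rowsOK rs

colsOK : List (List ℕ) → Bool
colsOK (r ∷ r' ∷ rs) = below r r' ∧ colsOK (r' ∷ rs)
colsOK _             = true

elem : ℕ → List ℕ → Bool
elem x []       = false
elem x (y ∷ ys) = (x ≡ᵇ y) ∨ elem x ys

distinct : List ℕ → Bool
distinct []       = true
distinct (x ∷ xs) = not (elem x xs) ∧ distinct xs

entries : List (List ℕ) → List ℕ
entries []       = []
entries (r ∷ rs) = r Data.List.++ entries rs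

-- A standard Young tableau of shape λ ⊢ n: a filling of the diagram with
-- pairwise distinct entries from {1,…,n} (hence each used exactly once),
-- strictly increasing along rows and down columns.
isSYT : List (List ℕ) → Bool
isSYT t = rowsOK t ∧ colsOK t ∧ distinct (entries t)

f : Partition → ℕ
f la = length (filter (λ t → T? (isSYT t)) (fillings la (map suc (upTo (size la)))))

rect : ℕ → ℕ → Partition
rect a b = replicate a b

Tends∞ : (ℕ → ℕ) → Set
Tends∞ a = ∀ M → ∃ λ N → ∀ s → N ≤ s → M ≤ a s

-- A standard grid of the a × b rectangle is a map ℕ → ℕ → ℕ that increases strictly
-- along rows and columns and is injective with values in 1..ab; read row by row it is a
-- standard Young tableau of shape (b^a), so f^(b^a) bounds the size of any family of
-- distinct standard grids.  We build such families indexed injectively by bit strings: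
--  * grids glue side by side or on top of each other after shifting their values;
--  * four grids of a K × K square glue into a 2K × 2K square whose off-diagonal quadrants
--    share the values n+1..3n (n = K²), each value x being sent to 2x-1 or 2x in the NE
--    quadrant (and to the other one in the SW quadrant) according to a free bit;
--  * iterating from the 1 × 1 square, the 2^j × 2^j square carries j/4 bits per cell, and
--    tiling an A × B rectangle by these squares for j = 16c gives at least c·AB bits once
--    A, B ≥ 2^j.  So f^(B^A) ≥ 2^(c·AB) (rectangle-bound), and c = p gives the theorem.

module Submission where

open import Defs
open import Data.Bool using (Bool; true; false; not; T; _∧_)
open import Data.Bool.Properties using (not-¬; T-∧; T?)
open import Data.Empty using (⊥-elim)
open import Data.List using (List; []; _∷_; length; map; filter; upTo; applyUpTo; _++_)
open import Data.List.Properties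
  using (∷-injectiveˡ; ∷-injectiveʳ; length-++; length-map; length-applyUpTo; length-removeAt′)
open import Data.List.Membership.Propositional using (_∈_)
open import Data.List.Membership.Propositional.Properties
  using (∈-applyUpTo⁻; ∈-++⁻; ∈-map⁺; ∈-map⁻; ∈-upTo⁺; ∈-filter⁺; ∈-concatMap⁺)
open import Data.List.Relation.Binary.Disjoint.Propositional using (Disjoint)
import Data.List.Relation.Unary.All as All
open import Data.List.Relation.Unary.AllPairs using ([]; _∷_)
open import Data.List.Relation.Unary.Any using (here; there; _─_)
import Data.List.Relation.Unary.Any as Any
open import Data.List.Relation.Unary.Unique.Propositional using (Unique)
open import Data.List.Relation.Unary.Unique.Propositional.Properties
  using (applyUpTo⁺₁; ++⁺; map⁺; Unique[x∷xs]⇒x∉xs)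
open import Data.Nat
  using (ℕ; zero; suc; _+_; _*_; _^_; _∸_; _<_; _≤_; _⊔_; z≤n; s≤s; z<s; _<?_; _≡ᵇ_; _≟_;
         NonZero; >-nonZero)
open import Data.Nat.DivMod using (_/_; _%_; m≡m%n+[m/n]*n; m%n<n; m≥n⇒m/n>0)
open import Data.Nat.Properties
open import Data.Nat.Solver using (module +-*-Solver)
open import Data.List.Membership.DecPropositional _≟_ using (_∈?_)
open import Data.Product using (∃; ∃₂; _×_; _,_; proj₁; proj₂; swap; uncurry; map₂)
open import Data.Product.Properties using (,-injective)
open import Data.Sum using (inj₁; inj₂)
open import Data.Unit using (tt)
open import Data.Vec using (Vec; []; _∷_; take; drop)
import Data.Vec as Vec
import Data.Vec.Properties as Vec
open import Function using (_∘_)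
open import Function.Bundles using (Equivalence)
open import Relation.Binary.Definitions using (tri<; tri≈; tri>)
open import Relation.Binary.PropositionalEquality
open import Relation.Nullary using (yes; no)

-- A grid assigns a value to each cell (row i, column j); only a finite rectangle matters.
Grid : Set
Grid = ℕ → ℕ → ℕ

Cells : ℕ → ℕ → (ℕ → Set) → Grid → Set
Cells a b P g = ∀ {i j} → i < a → j < b → P (g i j)

cells-map : ∀ {a b g} {P Q : ℕ → Set} → (∀ {x} → P x → Q x) → Cells a b P g → Cells a b Q g
cells-map f c i< j< = f (c i< j<)

Between : (ℕ → ℕ → Set) → ℕ → ℕ → Grid → ℕ → ℕ → Grid → Set
Between R a b g c d h = Cells a b (λ x → Cells c d (R x) h) g

Agree : ℕ → ℕ → Grid → Grid → Set
Agree a b g h = ∀ {i j} → i < a → j < b → g i j ≡ h i j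

CellInjective : ℕ → ℕ → Grid → Set
CellInjective a b g = ∀ {i j i' j'} → i < a → j < b → i' < a → j' < b →
                      g i j ≡ g i' j' → i ≡ i' × j ≡ j'

record Filling (a b : ℕ) (g : Grid) : Set where
  field
    row : ∀ {i j j'} → i < a → j < j' → j' < b → g i j < g i j'
    col : ∀ {i i' j} → i < i' → i' < a → j < b → g i j < g i' j
    inj : CellInjective a b g

InRange : ℕ → ℕ → ℕ → Set
InRange lo hi x = lo < x × x ≤ hi

-- A standard grid: a filling of the a × b rectangle by values from 1..ab.
-- (Injectivity then makes it a bijection onto 1..ab, see standard-onto.)
record Standard (a b : ℕ) (g : Grid) : Set where
  field
    filling : Filling a b g
    range   : Cells a b (InRange 0 (a * b)) g

widen : ∀ {a b g lo hi lo' hi'} → lo' ≤ lo → hi ≤ hi' →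
        Cells a b (InRange lo hi) g → Cells a b (InRange lo' hi') g
widen {lo = lo} {hi} {lo'} {hi'} lo'≤lo hi≤hi' = cells-map {P = InRange lo hi} {InRange lo' hi'}
  λ (lo<x , x≤hi) → ≤-<-trans lo'≤lo lo<x , ≤-trans x≤hi hi≤hi'

below-ranges : ∀ {a b c d g h lo m hi} → Cells a b (InRange lo m) g → Cells c d (InRange m hi) h →
               Between _<_ a b g c d h
below-ranges G H i< j< k< l< = ≤-<-trans (proj₂ (G i< j<)) (proj₁ (H k< l<))

apart-of-below : ∀ {a b c d g h} → Between _<_ a b g c d h → Between _≢_ a b g c d h
apart-of-below g<h i< j< k< l< = <⇒≢ (g<h i< j< k< l<)

transpose : Grid → Grid
transpose g i j = g j i

transpose-filling : ∀ {a b g} → Filling a b g → Filling b a (transpose g)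
transpose-filling F = record
  { row = λ i< j<j' j'< → col j<j' j'< i<
  ; col = λ i<i' i'< j< → row j< i<i' i'<
  ; inj = λ i< j< i'< j'< e → swap (inj j< i< j'< i'< e)
  }
  where open Filling F

transpose-standard : ∀ {a b g} → Standard a b g → Standard b a (transpose g)
transpose-standard {a} {b} {g} S = record
  { filling = transpose-filling filling
  ; range   = λ {i} {j} i< j< → subst (λ n → InRange 0 n (g j i)) (*-comm a b) (range j< i<)
  }
  where open Standard S

shift : ℕ → Grid → Grid
shift c g i j = c + g i j

shift-filling : ∀ {a b g} c → Filling a b g → Filling a b (shift c g)
shift-filling c F = record
  { row = λ i< j<j' j'< → +-monoʳ-< c (row i< j<j' j'<)
  ; col = λ i<i' i'< j< → +-monoʳ-< c (col i<i' i'< j<)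
  ; inj = λ i< j< i'< j'< e → inj i< j< i'< j'< (+-cancelˡ-≡ c _ _ e)
  }
  where open Filling F

shift-range : ∀ {a b g n} c → Cells a b (InRange 0 n) g → Cells a b (InRange c (c + n)) (shift c g)
shift-range {n = n} c = cells-map {P = InRange 0 n} λ (0<x , x≤n) → m<m+n c 0<x , +-monoʳ-≤ c x≤n

digit : Bool → ℕ
digit true  = 1
digit false = 2

digit-injective : ∀ {d d'} → digit d ≡ digit d' → d ≡ d'
digit-injective {true}  {true}  _ = refl
digit-injective {false} {false} _ = refl

digit≤2 : ∀ d → digit d ≤ 2
digit≤2 true  = s≤s z≤n
digit≤2 false = ≤-refl

0<digit : ∀ d → 0 < digit d
0<digit true  = s≤s z≤n
0<digit false = s≤s z≤n

-- spread c sends the value u + 1 to 2u + 1 or 2u + 2 according to the bit c u; it maps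
-- 1..n into 1..2n, and spread c and spread (not ∘ c) have disjoint images on 1..n.
spread : (ℕ → Bool) → ℕ → ℕ
spread c zero    = zero
spread c (suc u) = 2 * u + digit (c u)

spread≤double : ∀ c x → spread c x ≤ 2 * x
spread≤double c zero    = z≤n
spread≤double c (suc u) = begin
  2 * u + digit (c u) ≤⟨ +-monoʳ-≤ (2 * u) (digit≤2 (c u)) ⟩
  2 * u + 2           ≡⟨ +-comm (2 * u) 2 ⟩
  2 + 2 * u           ≡⟨ *-suc 2 u ⟨
  2 * suc u           ∎
  where open ≤-Reasoning

spread-mono : ∀ {x y} c c' → x < y → spread c x < spread c' y
spread-mono {x} {suc u'} c c' (s≤s x≤u') = begin-strict
  spread c x             ≤⟨ spread≤double c x ⟩
  2 * x                  ≤⟨ *-monoʳ-≤ 2 x≤u' ⟩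
  2 * u'                 <⟨ m<m+n (2 * u') (0<digit (c' u')) ⟩
  2 * u' + digit (c' u') ∎
  where open ≤-Reasoning

spread-injective : ∀ {x y} c c' → spread c x ≡ spread c' y → x ≡ y
spread-injective {x} {y} c c' e with <-cmp x y
... | tri< x<y _ _ = ⊥-elim (<⇒≢ (spread-mono c c' x<y) e)
... | tri≈ _ x≡y _ = x≡y
... | tri> _ _ y<x = ⊥-elim (<⇒≢ (spread-mono c' c y<x) (sym e))

spread-digit : ∀ c c' u → spread c (suc u) ≡ spread c' (suc u) → c u ≡ c' u
spread-digit c c' u e = digit-injective (+-cancelˡ-≡ (2 * u) _ _ e)

spread-apart : ∀ c {x y} → 0 < x → spread c x ≢ spread (not ∘ c) y
spread-apart c {suc u} {y} _ e with refl ← spread-injective {suc u} {y} c (not ∘ c) e =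
  not-¬ refl (spread-digit c (not ∘ c) u e)

spread-range : ∀ {n x} c → InRange 0 n x → InRange 0 (2 * n) (spread c x)
spread-range {x = x} c (0<x , x≤n) = spread-mono c c 0<x , ≤-trans (spread≤double c x) (*-monoʳ-≤ 2 x≤n)

spreadGrid : (ℕ → Bool) → Grid → Grid
spreadGrid c g i j = spread c (g i j)

spread-cells : ∀ {a b g n} c → Cells a b (InRange 0 n) g → Cells a b (InRange 0 (2 * n)) (spreadGrid c g)
spread-cells {n = n} c = cells-map {P = InRange 0 n} (spread-range c)

spread-filling : ∀ {a b g} c → Filling a b g → Filling a b (spreadGrid c g)
spread-filling c G = record
  { row = λ i< j<j' j'< → spread-mono c c (row i< j<j' j'<)
  ; col = λ i<i' i'< j< → spread-mono c c (col i<i' i'< j<)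
  ; inj = λ i< j< i'< j'< e → inj i< j< i'< j'< (spread-injective c c e)
  }
  where open Filling G

hglue : ℕ → Grid → Grid → Grid
hglue b₁ g h i j with j <? b₁
... | yes _ = g i j
... | no  _ = h i (j ∸ b₁)

hglue-left : ∀ {b₁ i j} (g h : Grid) → j < b₁ → hglue b₁ g h i j ≡ g i j
hglue-left {b₁} {j = j} g h j<b₁ with j <? b₁
... | yes _    = refl
... | no  j≮b₁ = ⊥-elim (j≮b₁ j<b₁)

hglue-right : ∀ {i} b₁ (g h : Grid) k → hglue b₁ g h i (b₁ + k) ≡ h i k
hglue-right {i} b₁ g h k with b₁ + k <? b₁
... | yes b₁+k<b₁ = ⊥-elim (m+n≮m b₁ k b₁+k<b₁)
... | no  _       = cong (h i) (m+n∸m≡n b₁ k)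

data Column (b₁ b₂ : ℕ) : ℕ → Set where
  left  : ∀ {j} → j < b₁ → Column b₁ b₂ j
  right : ∀ {k} → k < b₂ → Column b₁ b₂ (b₁ + k)

column : ∀ b₁ b₂ {j} → j < b₁ + b₂ → Column b₁ b₂ j
column b₁ b₂ {j} j< with j <? b₁
... | yes j<b₁ = left j<b₁
... | no  j≮b₁ with k , refl ← m≤n⇒∃[o]m+o≡n (≮⇒≥ j≮b₁) = right (+-cancelˡ-< b₁ k b₂ j<)

hglue-cells : ∀ {a b₁ b₂ g h} {P : ℕ → Set} → Cells a b₁ P g → Cells a b₂ P h →
              Cells a (b₁ + b₂) P (hglue b₁ g h)
hglue-cells {b₁ = b₁} {b₂} {g} {h} {P} G H i< j< with column b₁ b₂ j<
... | left  j<b₁       = subst P (sym (hglue-left g h j<b₁)) (G i< j<b₁)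
... | right {k} k<b₂   = subst P (sym (hglue-right b₁ g h k)) (H i< k<b₂)

hglue-columns : ∀ {a a' b₁ b₂ g h g' h'} (R : ℕ → ℕ → Set) →
  (∀ {i i' j} → i < a → i' < a' → j < b₁ → R (g i j) (g' i' j)) →
  (∀ {i i' j} → i < a → i' < a' → j < b₂ → R (h i j) (h' i' j)) →
  ∀ {i i' j} → i < a → i' < a' → j < b₁ + b₂ → R (hglue b₁ g h i j) (hglue b₁ g' h' i' j)
hglue-columns {b₁ = b₁} {b₂} {g} {h} {g'} {h'} R left-part right-part i< i'< j< with column b₁ b₂ j<
... | left  j<b₁     =
  subst₂ R (sym (hglue-left g h j<b₁)) (sym (hglue-left g' h' j<b₁)) (left-part i< i'< j<b₁)
... | right {k} k<b₂ =
  subst₂ R (sym (hglue-right b₁ g h k)) (sym (hglue-right b₁ g' h' k)) (right-part i< i'< k<b₂)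

hglue-agree : ∀ {a b₁ b₂ g h g' h'} → Agree a (b₁ + b₂) (hglue b₁ g h) (hglue b₁ g' h') →
              Agree a b₁ g g' × Agree a b₂ h h'
hglue-agree {b₁ = b₁} {b₂} {g} {h} {g'} {h'} agree =
  (λ i< j<b₁ → trans (sym (hglue-left g h j<b₁))
                     (trans (agree i< (<-≤-trans j<b₁ (m≤m+n b₁ b₂))) (hglue-left g' h' j<b₁))) ,
  (λ {_} {k} i< k<b₂ → trans (sym (hglue-right b₁ g h k))
                             (trans (agree i< (+-monoʳ-< b₁ k<b₂)) (hglue-right b₁ g' h' k)))

hglue-filling : ∀ {a b₁ b₂ g h} → Filling a b₁ g → Filling a b₂ h →
  (∀ {i j k} → i < a → j < b₁ → k < b₂ → g i j < h i k) →
  Between _≢_ a b₁ g a b₂ h → Filling a (b₁ + b₂) (hglue b₁ g h)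
hglue-filling {a} {b₁} {b₂} {g} {h} G H g<h g≢h = record { row = row ; col = col ; inj = inj }
  where
  module G = Filling G
  module H = Filling H
  at-left : ∀ {i j} → j < b₁ → hglue b₁ g h i j ≡ g i j
  at-left = hglue-left g h
  at-right : ∀ {i} k → hglue b₁ g h i (b₁ + k) ≡ h i k
  at-right = hglue-right b₁ g h

  row : ∀ {i j j'} → i < a → j < j' → j' < b₁ + b₂ → hglue b₁ g h i j < hglue b₁ g h i j'
  row i< j<j' j'< with column b₁ b₂ (<-trans j<j' j'<) | column b₁ b₂ j'<
  ... | left p  | left q  = subst₂ _<_ (sym (at-left p)) (sym (at-left q)) (G.row i< j<j' q)
  ... | left p  | right {k'} q = subst₂ _<_ (sym (at-left p)) (sym (at-right k')) (g<h i< p q)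
  ... | right {k} p | left q  = ⊥-elim (m+n≮m b₁ k (<-trans j<j' q))
  ... | right {k} p | right {k'} q =
    subst₂ _<_ (sym (at-right k)) (sym (at-right k')) (H.row i< (+-cancelˡ-< b₁ k k' j<j') q)

  col : ∀ {i i' j} → i < i' → i' < a → j < b₁ + b₂ → hglue b₁ g h i j < hglue b₁ g h i' j
  col i<i' i'< j< with column b₁ b₂ j<
  ... | left p       = subst₂ _<_ (sym (at-left p)) (sym (at-left p)) (G.col i<i' i'< p)
  ... | right {k} q  = subst₂ _<_ (sym (at-right k)) (sym (at-right k)) (H.col i<i' i'< q)

  inj : ∀ {i j i' j'} → i < a → j < b₁ + b₂ → i' < a → j' < b₁ + b₂ →
        hglue b₁ g h i j ≡ hglue b₁ g h i' j' → i ≡ i' × j ≡ j'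
  inj i< j< i'< j'< e with column b₁ b₂ j< | column b₁ b₂ j'<
  ... | left p  | left q  = G.inj i< p i'< q (subst₂ _≡_ (at-left p) (at-left q) e)
  ... | left p  | right {k'} q = ⊥-elim (g≢h i< p i'< q (subst₂ _≡_ (at-left p) (at-right k') e))
  ... | right {k} p | left q  = ⊥-elim (g≢h i'< q i< p (subst₂ _≡_ (at-left q) (at-right k) (sym e)))
  ... | right {k} p | right {k'} q
    with i≡i' , k≡k' ← H.inj i< p i'< q (subst₂ _≡_ (at-right k) (at-right k') e) =
    i≡i' , cong (b₁ +_) k≡k'

hglue-ordered : ∀ {a b₁ b₂ g h} → Filling a b₁ g → Filling a b₂ h →
  Between _<_ a b₁ g a b₂ h → Filling a (b₁ + b₂) (hglue b₁ g h)
hglue-ordered G H g<h = hglue-filling G H (λ i< j< k< → g<h i< j< i< k<) (apart-of-below g<h)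

vglue : ℕ → Grid → Grid → Grid
vglue a₁ g h = transpose (hglue a₁ (transpose g) (transpose h))

vglue-cells : ∀ {a₁ a₂ b g h} {P : ℕ → Set} → Cells a₁ b P g → Cells a₂ b P h →
              Cells (a₁ + a₂) b P (vglue a₁ g h)
vglue-cells {P = P} G H i< j< = hglue-cells {P = P} (λ j< i< → G i< j<) (λ j< i< → H i< j<) j< i<

vglue-agree : ∀ {a₁ a₂ b g h g' h'} → Agree (a₁ + a₂) b (vglue a₁ g h) (vglue a₁ g' h') →
              Agree a₁ b g g' × Agree a₂ b h h'
vglue-agree agree with agree-top , agree-bottom ← hglue-agree (λ j< i< → agree i< j<) =
  (λ i< j< → agree-top j< i<) , (λ i< j< → agree-bottom j< i<)

vglue-filling : ∀ {a₁ a₂ b g h} → Filling a₁ b g → Filling a₂ b h →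
  (∀ {i i' j} → i < a₁ → i' < a₂ → j < b → g i j < h i' j) →
  Between _≢_ a₁ b g a₂ b h → Filling (a₁ + a₂) b (vglue a₁ g h)
vglue-filling G H g<h g≢h =
  transpose-filling (hglue-filling (transpose-filling G) (transpose-filling H)
    (λ j< i< i'< → g<h i< i'< j<) (λ j< i< j'< i'< → g≢h i< j< i'< j'<))

block : ℕ → ℕ → Grid → Grid → Grid → Grid → Grid
block a₁ b₁ g₁ g₂ g₃ g₄ = vglue a₁ (hglue b₁ g₁ g₂) (hglue b₁ g₃ g₄)

block-filling : ∀ {a₁ a₂ b₁ b₂ g₁ g₂ g₃ g₄} →
  Filling a₁ b₁ g₁ → Filling a₁ b₂ g₂ → Filling a₂ b₁ g₃ → Filling a₂ b₂ g₄ →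
  Between _<_ a₁ b₁ g₁ a₁ b₂ g₂ → Between _<_ a₂ b₁ g₃ a₂ b₂ g₄ →
  Between _<_ a₁ b₁ g₁ a₂ b₁ g₃ → Between _<_ a₁ b₂ g₂ a₂ b₂ g₄ →
  Between _<_ a₁ b₁ g₁ a₂ b₂ g₄ → Between _≢_ a₁ b₂ g₂ a₂ b₁ g₃ →
  Filling (a₁ + a₂) (b₁ + b₂) (block a₁ b₁ g₁ g₂ g₃ g₄)
block-filling {a₁} {a₂} {b₁} {b₂} {g₁} {g₂} {g₃} {g₄}
              G₁ G₂ G₃ G₄ g₁<g₂ g₃<g₄ g₁<g₃ g₂<g₄ g₁<g₄ g₂≢g₃ =
  vglue-filling (hglue-ordered G₁ G₂ g₁<g₂) (hglue-ordered G₃ G₄ g₃<g₄) top<bottom top≢bottom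
  where
  top<bottom : ∀ {i i' j} → i < a₁ → i' < a₂ → j < b₁ + b₂ → hglue b₁ g₁ g₂ i j < hglue b₁ g₃ g₄ i' j
  top<bottom = hglue-columns _<_ (λ i< i'< j< → g₁<g₃ i< j< i'< j<) (λ i< i'< j< → g₂<g₄ i< j< i'< j<)
  top≢bottom : Between _≢_ a₁ (b₁ + b₂) (hglue b₁ g₁ g₂) a₂ (b₁ + b₂) (hglue b₁ g₃ g₄)
  top≢bottom = hglue-cells {P = λ x → Cells a₂ (b₁ + b₂) (x ≢_) (hglue b₁ g₃ g₄)}
    (λ i< j< → hglue-cells {P = _ ≢_} (apart-of-below g₁<g₃ i< j<) (apart-of-below g₁<g₄ i< j<))
    (λ i< j< → hglue-cells {P = _ ≢_} (g₂≢g₃ i< j<) (apart-of-below g₂<g₄ i< j<))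

block-agree : ∀ {a₁ a₂ b₁ b₂ g₁ g₂ g₃ g₄ h₁ h₂ h₃ h₄} →
  Agree (a₁ + a₂) (b₁ + b₂) (block a₁ b₁ g₁ g₂ g₃ g₄) (block a₁ b₁ h₁ h₂ h₃ h₄) →
  Agree a₁ b₁ g₁ h₁ × Agree a₁ b₂ g₂ h₂ × Agree a₂ b₁ g₃ h₃ × Agree a₂ b₂ g₄ h₄
block-agree {a₁} {a₂} {b₁} {b₂} agree
  with top , bottom ← vglue-agree {a₁} {a₂} {b₁ + b₂} agree
  with A₁ , A₂ ← hglue-agree {a₁} {b₁} {b₂} top | A₃ , A₄ ← hglue-agree {a₂} {b₁} {b₂} bottom =
  A₁ , A₂ , A₃ , A₄

T-both : ∀ {x y} → T x → T y → T (x ∧ y)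
T-both p q = Equivalence.from T-∧ (p , q)

tableauOf : ℕ → ℕ → Grid → List (List ℕ)
tableauOf a b g = applyUpTo (λ i → applyUpTo (g i) b) a

incr-applyUpTo : ∀ h k → (∀ {j} → suc j < k → h j < h (suc j)) → T (incr (applyUpTo h k))
incr-applyUpTo h zero          _    = tt
incr-applyUpTo h (suc zero)    _    = tt
incr-applyUpTo h (suc (suc k)) step =
  T-both (<⇒<ᵇ (step (s≤s (s≤s z≤n)))) (incr-applyUpTo (h ∘ suc) (suc k) (λ p → step (s≤s p)))

below-applyUpTo : ∀ h h' k → (∀ {j} → j < k → h j < h' j) → T (below (applyUpTo h k) (applyUpTo h' k))
below-applyUpTo h h' zero    _     = tt
below-applyUpTo h h' (suc k) above =
  T-both (<⇒<ᵇ (above z<s)) (below-applyUpTo (h ∘ suc) (h' ∘ suc) k (λ p → above (s≤s p)))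

rowsOK-applyUpTo : ∀ G a → (∀ {i} → i < a → T (incr (G i))) → T (rowsOK (applyUpTo G a))
rowsOK-applyUpTo G zero    _    = tt
rowsOK-applyUpTo G (suc a) rows = T-both (rows z<s) (rowsOK-applyUpTo (G ∘ suc) a (λ p → rows (s≤s p)))

colsOK-applyUpTo : ∀ G a → (∀ {i} → suc i < a → T (below (G i) (G (suc i)))) → T (colsOK (applyUpTo G a))
colsOK-applyUpTo G zero          _    = tt
colsOK-applyUpTo G (suc zero)    _    = tt
colsOK-applyUpTo G (suc (suc a)) cols =
  T-both (cols (s≤s (s≤s z≤n))) (colsOK-applyUpTo (G ∘ suc) (suc a) (λ p → cols (s≤s p)))

∈-entries : ∀ a b g {x} → x ∈ entries (tableauOf a b g) → ∃₂ λ i j → i < a × j < b × x ≡ g i j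
∈-entries (suc a) b g x∈ with ∈-++⁻ (applyUpTo (g 0) b) x∈
... | inj₁ x∈row with j , j< , refl ← ∈-applyUpTo⁻ (g 0) x∈row = 0 , j , z<s , j< , refl
... | inj₂ x∈rest with i , j , i< , j< , refl ← ∈-entries a b (g ∘ suc) x∈rest = suc i , j , s≤s i< , j< , refl

entries-unique : ∀ a b g → CellInjective a b g → Unique (entries (tableauOf a b g))
entries-unique zero    b g inj = []
entries-unique (suc a) b g inj = ++⁺ first-row-unique (entries-unique a b (g ∘ suc) inj-rest) disjoint
  where
  first-row-unique : Unique (applyUpTo (g 0) b)
  first-row-unique = applyUpTo⁺₁ (g 0) b λ j<j' j'< e →
    <⇒≢ j<j' (proj₂ (inj z<s (<-trans j<j' j'<) z<s j'< e))
  inj-rest : CellInjective a b (g ∘ suc)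
  inj-rest i< j< i'< j'< e with i≡i' , j≡j' ← inj (s≤s i<) j< (s≤s i'<) j'< e = suc-injective i≡i' , j≡j'
  disjoint : Disjoint (applyUpTo (g 0) b) (entries (tableauOf a b (g ∘ suc)))
  disjoint (x∈row , x∈rest) with j , j< , refl ← ∈-applyUpTo⁻ (g 0) x∈row
                              | i , j' , i< , j'< , e ← ∈-entries a b (g ∘ suc) x∈rest
    with () ← proj₁ (inj z<s j< (s≤s i<) j'< e)

length-entries : ∀ a b g → length (entries (tableauOf a b g)) ≡ a * b
length-entries zero    b g = refl
length-entries (suc a) b g = begin
  length (applyUpTo (g 0) b ++ entries (tableauOf a b (g ∘ suc)))
    ≡⟨ length-++ (applyUpTo (g 0) b) ⟩
  length (applyUpTo (g 0) b) + length (entries (tableauOf a b (g ∘ suc)))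
    ≡⟨ cong₂ _+_ (length-applyUpTo (g 0) b) (length-entries a b (g ∘ suc)) ⟩
  b + a * b ∎
  where open ≡-Reasoning

elem-sound : ∀ x xs → T (elem x xs) → x ∈ xs
elem-sound x (y ∷ ys) p with x ≡ᵇ y in eq
... | true  = here (≡ᵇ⇒≡ x y (subst T (sym eq) tt))
... | false = there (elem-sound x ys p)

distinct-unique : ∀ xs → Unique xs → T (distinct xs)
distinct-unique []       _              = tt
distinct-unique (x ∷ xs) u@(_ ∷ rest) with elem x xs in eq
... | true  = Unique[x∷xs]⇒x∉xs u (elem-sound x xs (subst T (sym eq) tt))
... | false = distinct-unique xs rest

listsOf-∈ : ∀ {A : Set} (h : ℕ → A) l xs → (∀ {j} → j < l → h j ∈ xs) → applyUpTo h l ∈ listsOf l xs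
listsOf-∈ h zero    xs _   = here refl
listsOf-∈ h (suc l) xs h∈ =
  ∈-concatMap⁺ (λ x → map (x ∷_) (listsOf l xs))
    (Any.map (λ { refl → ∈-map⁺ (h 0 ∷_) (listsOf-∈ (h ∘ suc) l xs (λ p → h∈ (s≤s p))) }) (h∈ z<s))

fillings-∈ : ∀ a b g xs → (∀ {i j} → i < a → j < b → g i j ∈ xs) → tableauOf a b g ∈ fillings (rect a b) xs
fillings-∈ zero    b g xs _   = here refl
fillings-∈ (suc a) b g xs g∈ =
  ∈-concatMap⁺ (λ row → map (row ∷_) (fillings (rect a b) xs))
    (Any.map (λ { refl → ∈-map⁺ (applyUpTo (g 0) b ∷_) (fillings-∈ a b (g ∘ suc) xs (λ p → g∈ (s≤s p))) })
             (listsOf-∈ (g 0) b xs (g∈ z<s)))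

applyUpTo-injective : ∀ {A : Set} (h h' : ℕ → A) k → applyUpTo h k ≡ applyUpTo h' k →
                      ∀ {j} → j < k → h j ≡ h' j
applyUpTo-injective h h' (suc k) e {zero}  _         = ∷-injectiveˡ e
applyUpTo-injective h h' (suc k) e {suc j} (s≤s j<k) = applyUpTo-injective (h ∘ suc) (h' ∘ suc) k (∷-injectiveʳ e) j<k

tableau-injective : ∀ a b g g' → tableauOf a b g ≡ tableauOf a b g' → Agree a b g g'
tableau-injective a b g g' e i< j< =
  applyUpTo-injective (g _) (g' _) b (applyUpTo-injective _ _ a e i<) j<

SYTs : Partition → List (List (List ℕ))
SYTs la = filter (λ t → T? (isSYT t)) (fillings la (map suc (upTo (size la))))

size-rect : ∀ a b → size (rect a b) ≡ a * b
size-rect zero    b = refl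
size-rect (suc a) b = cong (b +_) (size-rect a b)

∈-positives : ∀ {n x} → InRange 0 n x → x ∈ map suc (upTo n)
∈-positives {x = suc u} (_ , u<n) = ∈-map⁺ suc (∈-upTo⁺ u<n)

standard-∈-SYTs : ∀ {a b g} → Standard a b g → tableauOf a b g ∈ SYTs (rect a b)
standard-∈-SYTs {a} {b} {g} S = ∈-filter⁺ (λ t → T? (isSYT t)) in-fillings is-SYT
  where
  open Standard S
  open Filling filling
  in-fillings : tableauOf a b g ∈ fillings (rect a b) (map suc (upTo (size (rect a b))))
  in-fillings = fillings-∈ a b g _ λ i< j< →
    subst (λ n → g _ _ ∈ map suc (upTo n)) (sym (size-rect a b)) (∈-positives (range i< j<))
  is-SYT : T (isSYT (tableauOf a b g))
  is-SYT = T-both (rowsOK-applyUpTo _ a λ i< → incr-applyUpTo (g _) b λ sj< → row i< (n<1+n _) sj<)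
          (T-both (colsOK-applyUpTo _ a λ si< → below-applyUpTo (g _) (g _) b λ j< → col (n<1+n _) si< j<)
                  (distinct-unique _ (entries-unique a b g inj)))

module _ {A : Set} where

  ∈-─ : ∀ {x y : A} {ys} (x∈ys : x ∈ ys) → y ∈ ys → y ≢ x → y ∈ (ys ─ x∈ys)
  ∈-─ (here refl)  (here refl)  y≢x = ⊥-elim (y≢x refl)
  ∈-─ (here _)     (there y∈ys) _   = y∈ys
  ∈-─ (there _)    (here y≡z)   _   = here y≡z
  ∈-─ (there x∈ys) (there y∈ys) y≢x = there (∈-─ x∈ys y∈ys y≢x)

  unique-length : ∀ {xs ys : List A} → Unique xs → (∀ {x} → x ∈ xs → x ∈ ys) → length xs ≤ length ys
  unique-length {[]}     _              _   = z≤n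
  unique-length {x ∷ xs} {ys} (x≢xs ∷ u) sub = begin
    suc (length xs)          ≤⟨ s≤s (unique-length u λ y∈xs → ∈-─ x∈ys (sub (there y∈xs)) (x≢ y∈xs)) ⟩
    suc (length (ys ─ x∈ys)) ≡⟨ length-removeAt′ ys (Any.index x∈ys) ⟨
    length ys                ∎
    where
    open ≤-Reasoning
    x∈ys : x ∈ ys
    x∈ys = sub (here refl)
    x≢ : ∀ {y} → y ∈ xs → y ≢ x
    x≢ y∈xs = ≢-sym (All.lookup x≢xs y∈xs)

unique-saturates : ∀ {xs ys : List ℕ} → Unique xs → (∀ {x} → x ∈ xs → x ∈ ys) → length ys ≤ length xs →
                   ∀ {y} → y ∈ ys → y ∈ xs
unique-saturates {xs} {ys} u sub ys≤xs {y} y∈ys with y ∈? xs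
... | yes y∈xs = y∈xs
... | no  y∉xs = ⊥-elim (<⇒≱ shorter ys≤xs)
  where
  shorter : length xs < length ys
  shorter = subst (length xs <_) (sym (length-removeAt′ ys (Any.index y∈ys)))
    (s≤s (unique-length u λ x∈xs → ∈-─ y∈ys (sub x∈xs) λ { refl → y∉xs x∈xs }))

standard-onto : ∀ {a b g} → Standard a b g →
                ∀ {x} → x < a * b → ∃₂ λ i j → i < a × j < b × g i j ≡ suc x
standard-onto {a} {b} {g} S {x} x< =
  let i , j , i< , j< , e = ∈-entries a b g hit in i , j , i< , j< , sym e
  where
  open Standard S
  entries⊆ : ∀ {y} → y ∈ entries (tableauOf a b g) → y ∈ map suc (upTo (a * b))
  entries⊆ y∈ with i , j , i< , j< , refl ← ∈-entries a b g y∈ = ∈-positives (range i< j<)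
  same-length : length (map suc (upTo (a * b))) ≤ length (entries (tableauOf a b g))
  same-length = ≤-reflexive (trans (length-map suc (upTo (a * b)))
                            (trans (length-applyUpTo (λ k → k) (a * b)) (sym (length-entries a b g))))
  hit : suc x ∈ entries (tableauOf a b g)
  hit = unique-saturates (entries-unique a b g (Filling.inj filling)) entries⊆ same-length
          (∈-map⁺ suc (∈-upTo⁺ x<))

record Family (a b : ℕ) (I : Set) : Set where
  field
    grid      : I → Grid
    standard  : ∀ x → Standard a b (grid x)
    injective : ∀ {x y} → Agree a b (grid x) (grid y) → x ≡ y

family-bound : ∀ {a b I} → Family a b I → (xs : List I) → Unique xs → length xs ≤ f (rect a b)
family-bound {a} {b} {I} F xs u =
  subst (_≤ f (rect a b)) (length-map read xs)
    (unique-length (map⁺ (λ e → injective (tableau-injective a b _ _ e)) u) read-is-SYT)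
  where
  open Family F
  read : I → List (List ℕ)
  read x = tableauOf a b (grid x)
  read-is-SYT : ∀ {t} → t ∈ map read xs → t ∈ SYTs (rect a b)
  read-is-SYT t∈ with x , _ , refl ← ∈-map⁻ read t∈ = standard-∈-SYTs (standard x)

Code : ℕ → Set
Code = Vec Bool

allCodes : ∀ m → List (Code m)
allCodes zero    = [] ∷ []
allCodes (suc m) = map (true ∷_) (allCodes m) ++ map (false ∷_) (allCodes m)

allCodes-unique : ∀ m → Unique (allCodes m)
allCodes-unique zero    = All.[] ∷ []
allCodes-unique (suc m) =
  ++⁺ (map⁺ Vec.∷-injectiveʳ (allCodes-unique m)) (map⁺ Vec.∷-injectiveʳ (allCodes-unique m)) heads-differ
  where
  heads-differ : Disjoint (map (true ∷_) (allCodes m)) (map (false ∷_) (allCodes m))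
  heads-differ (w∈ , w∈') with _ , _ , refl ← ∈-map⁻ (true ∷_) w∈
    with _ , _ , () ← ∈-map⁻ (false ∷_) w∈'

length-allCodes : ∀ m → length (allCodes m) ≡ 2 ^ m
length-allCodes zero    = refl
length-allCodes (suc m) = begin
  length (map (true ∷_) (allCodes m) ++ map (false ∷_) (allCodes m))
    ≡⟨ length-++ (map (true ∷_) (allCodes m)) ⟩
  length (map (true ∷_) (allCodes m)) + length (map (false ∷_) (allCodes m))
    ≡⟨ cong₂ _+_ (length-map (true ∷_) (allCodes m)) (length-map (false ∷_) (allCodes m)) ⟩
  length (allCodes m) + length (allCodes m)
    ≡⟨ cong (λ k → k + k) (length-allCodes m) ⟩
  2 ^ m + 2 ^ m
    ≡⟨ cong (2 ^ m +_) (+-identityʳ (2 ^ m)) ⟨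
  2 ^ suc m ∎
  where open ≡-Reasoning

codes-bound : ∀ {a b m} → Family a b (Code m) → 2 ^ m ≤ f (rect a b)
codes-bound {m = m} F = subst (_≤ _) (length-allCodes m) (family-bound F (allCodes m) (allCodes-unique m))

reindex : ∀ {a b I J} → Family a b I → (h : J → I) → (∀ {x y} → h x ≡ h y → x ≡ y) → Family a b J
reindex F h h-injective = record
  { grid      = grid ∘ h
  ; standard  = standard ∘ h
  ; injective = h-injective ∘ injective
  }
  where open Family F

unconcat : ∀ m {n} → Code (m + n) → Code m × Code n
unconcat m w = take m w , drop m w

unconcat-injective : ∀ m {n} {w w' : Code (m + n)} → unconcat m w ≡ unconcat m w' → w ≡ w'
unconcat-injective m {w = w} {w'} e = begin
  w                          ≡⟨ Vec.take++drop≡id m w ⟨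
  take m w Vec.++ drop m w   ≡⟨ cong (uncurry Vec._++_) e ⟩
  take m w' Vec.++ drop m w' ≡⟨ Vec.take++drop≡id m w' ⟩
  w'                         ∎
  where open ≡-Reasoning

transpose-family : ∀ {a b I} → Family a b I → Family b a I
transpose-family F = record
  { grid      = transpose ∘ grid
  ; standard  = transpose-standard ∘ standard
  ; injective = λ agree → injective (λ i< j< → agree j< i<)
  }
  where open Family F

hcat-family : ∀ {a b₁ b₂ I J} → Family a b₁ I → Family a b₂ J → Family a (b₁ + b₂) (I × J)
hcat-family {a} {b₁} {b₂} {I} {J} F G = record
  { grid      = glued
  ; standard  = glued-standard
  ; injective = glued-injective
  }
  where
  module F = Family F
  module G = Family G
  glued : I × J → Grid
  glued (x , y) = hglue b₁ (F.grid x) (shift (a * b₁) (G.grid y))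
  glued-standard : ∀ p → Standard a (b₁ + b₂) (glued p)
  glued-standard (x , y) = record
    { filling = hglue-ordered (Standard.filling Fx) (shift-filling (a * b₁) (Standard.filling Gy))
                  (below-ranges (Standard.range Fx) right-range)
    ; range   = hglue-cells {P = InRange 0 (a * (b₁ + b₂))}
                  (widen ≤-refl (*-monoʳ-≤ a (m≤m+n b₁ b₂)) (Standard.range Fx))
                  (widen z≤n (≤-reflexive (sym (*-distribˡ-+ a b₁ b₂))) right-range)
    }
    where
    Fx : Standard a b₁ (F.grid x)
    Fx = F.standard x
    Gy : Standard a b₂ (G.grid y)
    Gy = G.standard y
    right-range : Cells a b₂ (InRange (a * b₁) (a * b₁ + a * b₂)) (shift (a * b₁) (G.grid y))
    right-range = shift-range (a * b₁) (Standard.range Gy)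
  glued-injective : ∀ {p q} → Agree a (b₁ + b₂) (glued p) (glued q) → p ≡ q
  glued-injective {x , y} {x' , y'} agree with agree-left , agree-right ← hglue-agree agree =
    cong₂ _,_ (F.injective agree-left) (G.injective λ i< j< → +-cancelˡ-≡ (a * b₁) _ _ (agree-right i< j<))

hcat-codes : ∀ {a b₁ b₂ m n} → Family a b₁ (Code m) → Family a b₂ (Code n) →
             Family a (b₁ + b₂) (Code (m + n))
hcat-codes {m = m} F G = reindex (hcat-family F G) (unconcat m) (unconcat-injective m)

rowMajor : ℕ → Grid
rowMajor b i j = suc (j + i * b)

rowMajor-mono : ∀ {b i i' j} j' → j < b → i < i' → j + i * b < j' + i' * b
rowMajor-mono {b} {i} {i'} {j} j' j<b i<i' = begin-strict
  j + i * b   <⟨ +-monoˡ-< (i * b) j<b ⟩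
  suc i * b   ≤⟨ *-monoˡ-≤ b i<i' ⟩
  i' * b      ≤⟨ m≤n+m (i' * b) j' ⟩
  j' + i' * b ∎
  where open ≤-Reasoning

rowMajor-standard : ∀ a b → Standard a b (rowMajor b)
rowMajor-standard a b = record
  { filling = record
    { row = λ i< j<j' j'< → s≤s (+-monoˡ-< _ j<j')
    ; col = λ {i} {i'} {j} i<i' i'< j< → s≤s (rowMajor-mono j j< i<i')
    ; inj = inj
    }
  ; range = λ {i} i< j< → z<s , ≤-trans (rowMajor-mono 0 j< (n<1+n i)) (*-monoˡ-≤ b i<)
  }
  where
  inj : CellInjective a b (rowMajor b)
  inj {i} {j} {i'} {j'} i< j< i'< j'< e with <-cmp i i'
  ... | tri< i<i' _ _ = ⊥-elim (<⇒≢ (s≤s (rowMajor-mono j' j< i<i')) e)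
  ... | tri≈ _ refl _ = refl , +-cancelʳ-≡ (i * b) j j' (suc-injective e)
  ... | tri> _ _ i'<i = ⊥-elim (<⇒≢ (s≤s (rowMajor-mono j j'< i'<i)) (sym e))

base-family : ∀ a b → Family a b (Code 0)
base-family a b = record
  { grid      = λ _ → rowMajor b
  ; standard  = λ _ → rowMajor-standard a b
  ; injective = λ { {[]} {[]} _ → refl }
  }

hrepeat : ∀ {a b r m} → Family a b (Code m) → Family a r (Code 0) → ∀ t → Family a (t * b + r) (Code (t * m))
hrepeat F R zero = R
hrepeat {a} {b} {r} {m} F R (suc t) =
  subst (λ w → Family a w (Code (suc t * m))) (sym (+-assoc b (t * b) r)) (hcat-codes F (hrepeat F R t))

vrepeat : ∀ {a b r m} → Family a b (Code m) → Family r b (Code 0) → ∀ s → Family (s * a + r) b (Code (s * m))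
vrepeat F R s = transpose-family (hrepeat (transpose-family F) (transpose-family R) s)

tile : ∀ {K B} → Family K K (Code B) → ∀ s r t r' → Family (s * K + r) (t * K + r') (Code (s * (t * B)))
tile {K} F s r t r' = vrepeat (hrepeat F (base-family K r') t) (base-family r (t * K + r')) s

bitAt : ∀ {n} → Code n → ℕ → Bool
bitAt []      _       = false
bitAt (d ∷ v) zero    = d
bitAt (d ∷ v) (suc u) = bitAt v u

bits-ext : ∀ {n} (v v' : Code n) → (∀ {u} → u < n → bitAt v u ≡ bitAt v' u) → v ≡ v'
bits-ext []      []        _     = refl
bits-ext (d ∷ v) (d' ∷ v') same = cong₂ _∷_ (same z<s) (bits-ext v v' λ u< → same (s≤s u<))

quad-size : ∀ K → (K + K) * (K + K) ≡ K * K + 2 * (K * K) + K * K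
quad-size K = solve 1 (λ K → (K :+ K) :* (K :+ K) := K :* K :+ con 2 :* (K :* K) :+ K :* K) refl K
  where open +-*-Solver

-- With n = K², the NW quadrant takes the values
-- 1..n, the SE quadrant 3n+1..4n, and the NE and SW quadrants spread their grids over
-- n+1..3n with complementary bits; standard-onto lets every bit be read back.
quad-family : ∀ {K I} → Family K K I → Family (K + K) (K + K) (I × I × I × I × Code (K * K))
quad-family {K} {I} F = record { grid = quad ; standard = quad-standard ; injective = quad-injective }
  where
  open Family F
  n : ℕ
  n = K * K
  quad : I × I × I × I × Code (K * K) → Grid
  quad (x₁ , x₂ , x₃ , x₄ , v) =
    block K K (grid x₁) (shift n (spreadGrid (bitAt v) (grid x₂)))
              (shift n (spreadGrid (not ∘ bitAt v) (grid x₃))) (shift (n + 2 * n) (grid x₄))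

  quad-standard : ∀ p → Standard (K + K) (K + K) (quad p)
  quad-standard (x₁ , x₂ , x₃ , x₄ , v) = record
    { filling = block-filling (filling x₁) (shift-filling n (spread-filling c (filling x₂)))
                  (shift-filling n (spread-filling (not ∘ c) (filling x₃))) (shift-filling (n + 2 * n) (filling x₄))
                  (below-ranges R₁ R₂) (below-ranges R₃ R₄) (below-ranges R₁ R₃) (below-ranges R₂ R₄)
                  (below-ranges R₁ (widen (m≤m+n n (2 * n)) ≤-refl R₄))
                  (λ i< j< {i'} {j'} _ _ e →
                     spread-apart c {y = grid x₃ i' j'} (proj₁ (range x₂ i< j<)) (+-cancelˡ-≡ n _ _ e))
    ; range   = subst (λ N → Cells (K + K) (K + K) (InRange 0 N) (quad (x₁ , x₂ , x₃ , x₄ , v)))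
                      (sym (quad-size K))
                  (vglue-cells {P = InRange 0 total}
                    (hglue-cells {P = InRange 0 total} (widen ≤-refl (≤-trans (m≤m+n n _) (m≤m+n _ n)) R₁)
                                                       (widen z≤n (m≤m+n _ n) R₂))
                    (hglue-cells {P = InRange 0 total} (widen z≤n (m≤m+n _ n) R₃) (widen z≤n ≤-refl R₄)))
    }
    where
    c : ℕ → Bool
    c = bitAt v
    filling : ∀ x → Filling K K (grid x)
    filling x = Standard.filling (standard x)
    range : ∀ x → Cells K K (InRange 0 n) (grid x)
    range x = Standard.range (standard x)
    total : ℕ
    total = n + 2 * n + n
    R₁ : Cells K K (InRange 0 n) (grid x₁)
    R₁ = range x₁
    R₂ : Cells K K (InRange n (n + 2 * n)) (shift n (spreadGrid c (grid x₂)))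
    R₂ = shift-range n (spread-cells c (range x₂))
    R₃ : Cells K K (InRange n (n + 2 * n)) (shift n (spreadGrid (not ∘ c) (grid x₃)))
    R₃ = shift-range n (spread-cells (not ∘ c) (range x₃))
    R₄ : Cells K K (InRange (n + 2 * n) (n + 2 * n + n)) (shift (n + 2 * n) (grid x₄))
    R₄ = shift-range (n + 2 * n) (range x₄)

  quad-injective : ∀ {p q} → Agree (K + K) (K + K) (quad p) (quad q) → p ≡ q
  quad-injective {x₁ , x₂ , x₃ , x₄ , v} {y₁ , y₂ , y₃ , y₄ , w} agree
    with A₁ , A₂ , A₃ , A₄ ← block-agree {K} {K} {K} {K} agree =
    cong₂ _,_ x₁≡y₁ (cong₂ _,_ x₂≡y₂ (cong₂ _,_ x₃≡y₃ (cong₂ _,_ x₄≡y₄ v≡w)))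
    where
    c c' : ℕ → Bool
    c = bitAt v
    c' = bitAt w
    spread₂ : Agree K K (spreadGrid c (grid x₂)) (spreadGrid c' (grid y₂))
    spread₂ i< j< = +-cancelˡ-≡ n _ _ (A₂ i< j<)
    x₁≡y₁ : x₁ ≡ y₁
    x₁≡y₁ = injective A₁
    x₂≡y₂ : x₂ ≡ y₂
    x₂≡y₂ = injective λ i< j< → spread-injective c c' (spread₂ i< j<)
    x₃≡y₃ : x₃ ≡ y₃
    x₃≡y₃ = injective λ i< j< → spread-injective (not ∘ c) (not ∘ c') (+-cancelˡ-≡ n _ _ (A₃ i< j<))
    x₄≡y₄ : x₄ ≡ y₄
    x₄≡y₄ = injective λ i< j< → +-cancelˡ-≡ (n + 2 * n) _ _ (A₄ i< j<)
    same-bit : ∀ {u} → u < n → c u ≡ c' u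
    same-bit {u} u< =
      let i , j , i< , j< , hit = standard-onto (standard x₂) u<
          hit' = trans (cong (λ x → grid x i j) (sym x₂≡y₂)) hit
      in spread-digit c c' u (subst₂ (λ z z' → spread c z ≡ spread c' z') hit hit' (spread₂ i< j<))
    v≡w : v ≡ w
    v≡w = bits-ext v w same-bit

map₂-injective : ∀ {A B C : Set} {h : B → C} → (∀ {x y} → h x ≡ h y → x ≡ y) →
                 ∀ {p q : A × B} → map₂ h p ≡ map₂ h q → p ≡ q
map₂-injective h-injective {_ , _} {_ , _} e with refl , hb≡hb' ← ,-injective e = cong (_ ,_) (h-injective hb≡hb')

quad-codes : ∀ {K m} → Family K K (Code m) → Family (K + K) (K + K) (Code (m + (m + (m + (m + K * K)))))
quad-codes {K} {m} F = reindex (quad-family F) split split-injective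
  where
  split : Code (m + (m + (m + (m + K * K)))) → Code m × Code m × Code m × Code m × Code (K * K)
  split = map₂ (map₂ (map₂ (unconcat m))) ∘ map₂ (map₂ (unconcat m)) ∘ map₂ (unconcat m) ∘ unconcat m
  split-injective : ∀ {w w'} → split w ≡ split w' → w ≡ w'
  split-injective e =
    unconcat-injective m
      (map₂-injective (unconcat-injective m)
        (map₂-injective (map₂-injective (unconcat-injective m))
          (map₂-injective (map₂-injective (map₂-injective (unconcat-injective m))) e)))

squareBits : ℕ → ℕ
squareBits zero    = 0
squareBits (suc j) = B + (B + (B + (B + 2 ^ j * 2 ^ j)))
  where
  B : ℕ
  B = squareBits j

square-family : ∀ j → Family (2 ^ j) (2 ^ j) (Code (squareBits j))
square-family zero    = base-family 1 1
square-family (suc j) =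
  subst (λ k → Family k k (Code (squareBits (suc j)))) (cong (2 ^ j +_) (sym (+-identityʳ (2 ^ j))))
        (quad-codes (square-family j))

squareBits-formula : ∀ j → 4 * squareBits j ≡ j * (2 ^ j * 2 ^ j)
squareBits-formula zero    = refl
squareBits-formula (suc j) = begin
  4 * (B + (B + (B + (B + K * K))))      ≡⟨ solve 2 (λ B K → con 4 :* (B :+ (B :+ (B :+ (B :+ K :* K))))
                                                      := con 4 :* (con 4 :* B) :+ con 4 :* (K :* K)) refl B K ⟩
  4 * (4 * B) + 4 * (K * K)              ≡⟨ cong (λ z → 4 * z + 4 * (K * K)) (squareBits-formula j) ⟩
  4 * (j * (K * K)) + 4 * (K * K)        ≡⟨ solve 2 (λ j K → con 4 :* (j :* (K :* K)) :+ con 4 :* (K :* K)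
                                                      := (con 1 :+ j) :* ((K :+ (K :+ con 0)) :* (K :+ (K :+ con 0)))) refl j K ⟩
  suc j * (2 ^ suc j * 2 ^ suc j)        ∎
  where
  open ≡-Reasoning
  open +-*-Solver
  B K : ℕ
  B = squareBits j
  K = 2 ^ j

at-most-twice-floor : ∀ {A K} .{{_ : NonZero K}} → K ≤ A → A ≤ 2 * (A / K * K)
at-most-twice-floor {A} {K} K≤A = begin
  A                        ≡⟨ m≡m%n+[m/n]*n A K ⟩
  A % K + A / K * K        ≤⟨ +-monoˡ-≤ (A / K * K) (<⇒≤ (<-≤-trans (m%n<n A K) K≤floor)) ⟩
  A / K * K + A / K * K    ≡⟨ cong (A / K * K +_) (+-identityʳ (A / K * K)) ⟨
  2 * (A / K * K)          ∎
  where
  open ≤-Reasoning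
  K≤floor : K ≤ A / K * K
  K≤floor = subst (_≤ A / K * K) (*-identityˡ K) (*-monoˡ-≤ K (m≥n⇒m/n>0 K≤A))

enough-bits : ∀ c A B s t → A ≤ 2 * (s * 2 ^ (16 * c)) → B ≤ 2 * (t * 2 ^ (16 * c)) →
  c * (A * B) ≤ s * (t * squareBits (16 * c))
enough-bits c A B s t A≤ B≤ = *-cancelˡ-≤ 16 (begin
  16 * (c * (A * B))                     ≡⟨ *-assoc 16 c (A * B) ⟨
  j * (A * B)                            ≤⟨ *-monoʳ-≤ j (*-mono-≤ A≤ B≤) ⟩
  j * (2 * (s * K) * (2 * (t * K)))      ≡⟨ solve 4 (λ j s t K → j :* (con 2 :* (s :* K) :* (con 2 :* (t :* K)))
                                                      := con 4 :* (s :* t) :* (j :* (K :* K))) refl j s t K ⟩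
  4 * (s * t) * (j * (K * K))            ≡⟨ cong (4 * (s * t) *_) (squareBits-formula j) ⟨
  4 * (s * t) * (4 * Bits)               ≡⟨ solve 3 (λ s t B → con 4 :* (s :* t) :* (con 4 :* B)
                                                      := con 16 :* (s :* (t :* B))) refl s t Bits ⟩
  16 * (s * (t * Bits))                  ∎)
  where
  open ≤-Reasoning
  open +-*-Solver
  j K Bits : ℕ
  j = 16 * c
  K = 2 ^ j
  Bits = squareBits j

rectangle-bound : ∀ c A B → 2 ^ (16 * c) ≤ A → 2 ^ (16 * c) ≤ B → 2 ^ (c * (A * B)) ≤ f (rect A B)
rectangle-bound c A B K≤A K≤B =
  ≤-trans (^-monoʳ-≤ 2 (enough-bits c A B (A / K) (B / K) (at-most-twice-floor K≤A)
                                                          (at-most-twice-floor K≤B)))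
          (codes-bound tiled)
  where
  K : ℕ
  K = 2 ^ (16 * c)
  instance
    _ : NonZero K
    _ = m^n≢0 2 (16 * c)
  divmod : ∀ X → X ≡ X / K * K + X % K
  divmod X = trans (m≡m%n+[m/n]*n X K) (+-comm (X % K) (X / K * K))
  tiled : Family A B (Code (A / K * (B / K * squareBits (16 * c))))
  tiled = subst₂ (λ x y → Family x y (Code (A / K * (B / K * squareBits (16 * c)))))
                 (sym (divmod A)) (sym (divmod B))
            (tile (square-family (16 * c)) (A / K) (A % K) (B / K) (B % K))

n<2^n : ∀ n → n < 2 ^ n
n<2^n zero    = z<s
n<2^n (suc n) = begin-strict
  suc n         ≤⟨ n<2^n n ⟩
  2 ^ n         <⟨ m<m+n (2 ^ n) (m^n>0 2 n) ⟩
  2 ^ n + 2 ^ n ≡⟨ cong (2 ^ n +_) (+-identityʳ (2 ^ n)) ⟨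
  2 ^ suc n     ∎
  where open ≤-Reasoning

rectangle-beats : ∀ p q A B → 0 < q → 2 ^ (16 * p) ≤ A → 2 ^ (16 * p) ≤ B →
                  p ^ (A * B) < f (rect A B) * q ^ (A * B)
rectangle-beats p q A B 0<q K≤A K≤B = begin-strict
  p ^ N                 <⟨ ^-monoˡ-< N (n<2^n p) ⟩
  (2 ^ p) ^ N           ≡⟨ ^-*-assoc 2 p N ⟩
  2 ^ (p * N)           ≤⟨ rectangle-bound p A B K≤A K≤B ⟩
  f (rect A B)          ≤⟨ m≤m*n (f (rect A B)) (q ^ N) ⟩
  f (rect A B) * q ^ N  ∎
  where
  open ≤-Reasoning
  N : ℕ
  N = A * B
  0<K : 0 < 2 ^ (16 * p)
  0<K = m^n>0 2 (16 * p)
  instance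
    _ : NonZero N
    _ = m*n≢0 A B {{>-nonZero (<-≤-trans 0<K K≤A)}} {{>-nonZero (<-≤-trans 0<K K≤B)}}
    _ : NonZero (q ^ N)
    _ = m^n≢0 q N {{>-nonZero 0<q}}

-- Lemma 3.4 with β = p / q: eventually f^(b_s^(a_s)) > (p / q) ^ (a_s b_s).
lemma3p4 : (a b : ℕ → ℕ) → Tends∞ a → Tends∞ b →
    (p q : ℕ) → 0 < p → 0 < q →
    ∃ λ s₀ → ∀ s → s₀ ≤ s →
    p ^ (a s * b s) < f (rect (a s) (b s)) * q ^ (a s * b s)
lemma3p4 a b a→∞ b→∞ p q _ 0<q
  with Na , a-large ← a→∞ (2 ^ (16 * p)) | Nb , b-large ← b→∞ (2 ^ (16 * p)) =
  Na ⊔ Nb , λ s s₀≤s → rectangle-beats p q (a s) (b s) 0<q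
    (a-large s (≤-trans (m≤m⊔n Na Nb) s₀≤s)) (b-large s (≤-trans (m≤n⊔m Na Nb) s₀≤s))
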